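{- Let $c\ge 2$ and $n\ge 1$ be integers and $a\neq b$ colors in $\{1,\dots,c\}$. Then $$\left|\Pi_n^{eq}\wr C_c(1^a1^a1^a)\right|=\left|\Pi_n^{eq}\wr C_c(1^a1^a1^b)\right|.$$
   Context: $\Pi_n\wr C_c$ is the set of colored set partitions of $[n]$: a set partition of $[n]$ together with a color in $\{1,\dots,c\}$ for each element. For colors $\gamma_1,\gamma_2,\gamma_3$, a colored partition eq-contains $1^{\gamma_1}1^{\gamma_2}1^{\gamma_3}$ iff some block contains elements $x<y<z$ with $x,y,z$ colored $\gamma_1,\gamma_2,\gamma_3$ respectively; $\Pi_n^{eq}\wr C_c(P)$ is the set of colored partitions not eq-containing $P$. -}

module Defs where

open import Data.Nat using (ℕ; zero; suc)
open import Data.Fin using (Fin; _<_)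
open import Data.Vec using (Vec; lookup)
open import Data.Product using (_×_; _,_; ∃-syntax)
open import Data.Sum using (_⊎_)
open import Data.Refinement using (Refinement)
open import Relation.Binary.PropositionalEquality using (_≡_)
open import Relation.Nullary using (¬_)

-- A set partition of [n] = Fin n is encoded canonically by its
-- restricted growth string: block label f i ∈ ℕ for each element i,
-- with elements in the same block iff they have the same label, and
-- labels assigned in order of first appearance (block of the least
-- element is 0, and a new block gets 1 + the largest label so far).
IsRGS : {n : ℕ} → Vec ℕ n → Set
IsRGS {n} f = (i : Fin n) →
  (lookup f i ≡ 0) ⊎ (∃[ j ] (j < i × suc (lookup f j) ≡ lookup f i))

RawColPart : ℕ → ℕ → Set
RawColPart n c = Vec ℕ n × Vec (Fin c) n

IsColPart : {n c : ℕ} → RawColPart n c → Set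
IsColPart (f , _) = IsRGS f

EqContains : {n c : ℕ} → RawColPart n c → Fin c → Fin c → Fin c → Set
EqContains {n} (f , col) g₁ g₂ g₃ = ∃[ x ] ∃[ y ] ∃[ z ]
  ( x < y × y < z
  × lookup f x ≡ lookup f y × lookup f y ≡ lookup f z
  × lookup col x ≡ g₁ × lookup col y ≡ g₂ × lookup col z ≡ g₃ )

-- Π_n^{eq} ≀ C_c (1^g1 1^g2 1^g3): colored partitions of [n] avoiding
-- the pattern (proofs are irrelevant, so elements are determined by
-- their raw data).
AvoidSet : (n c : ℕ) → Fin c → Fin c → Fin c → Set
AvoidSet n c g₁ g₂ g₃ =
  Refinement (RawColPart n c) (λ p → IsColPart p × ¬ EqContains p g₁ g₂ g₃)

module Submission where

-- Fix a colour a.  Call an element z of a coloured set partition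
-- *saturated* if its block contains two a-coloured elements x < y < z.
-- An occurrence of 1^a1^a1^e is exactly a saturated element coloured e.
--
-- Given a map σ on colours, *recolouring* by σ applies σ to the colour of
-- every saturated element and leaves the partition and all other colours
-- alone.  The key fact is that recolouring does not change which elements
-- are saturated (the first two a-coloured elements of a block are never
-- saturated, hence never recoloured).  Consequently
--   * recolouring by σ and then by a left inverse τ of σ is the identity;
--   * a recoloured partition contains 1^a1^a1^e iff the original contains
--     1^a1^a1^(τ e).
-- So for every permutation π of the colours, recolouring by π is a
-- bijection between the partitions avoiding 1^a1^a1^d and those avoiding
-- 1^a1^a1^(π d).  The theorem is the case π = transposition (a b), d = a.

open import Defs
open import Data.Nat using (ℕ; _≤_)
open import Data.Fin using (Fin; _<_)
open import Function.Bundles using (_↔_; mk↔ₛ′)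
open import Function using (_∘_)
open import Relation.Binary.PropositionalEquality
  using (_≡_; _≢_; refl; sym; trans; cong; subst; module ≡-Reasoning)
import Data.Nat as ℕ
open import Data.Fin.Properties using (any?; _<?_; <-trans) renaming (_≟_ to _≟ᶠ_)
open import Data.Fin.Induction using (<-wellFounded)
open import Data.Fin.Permutation using (Permutation; _⟨$⟩ʳ_; _⟨$⟩ˡ_; inverseˡ; inverseʳ; transpose)
open import Data.Vec using (Vec; lookup; tabulate)
open import Data.Vec.Properties using (lookup∘tabulate)
open import Data.Vec.Relation.Binary.Pointwise.Extensional using (ext; Pointwise-≡⇒≡)
open import Data.Product using (_×_; _,_; ∃-syntax)
open import Data.Refinement as Refinement using (Refinement; value; value-injective)
open import Induction.WellFounded using (Acc; acc)
open import Relation.Nullary using (Dec; yes; no; ¬_; contradiction)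
open import Relation.Nullary.Decidable using (_×-dec_; dec-true)

transpose-sends : ∀ {c} (i j : Fin c) → transpose i j ⟨$⟩ʳ i ≡ j
transpose-sends i j rewrite dec-true (i ≟ᶠ i) refl = refl

refinement-↔ : ∀ {A B : Set} {Q : A → Set} {R : B → Set} (f : A → B) (g : B → A) →
  (∀ x → Q x → R (f x)) → (∀ x → R x → Q (g x)) →
  (∀ x → f (g x) ≡ x) → (∀ x → g (f x) ≡ x) →
  Refinement A Q ↔ Refinement B R
refinement-↔ f g f-ok g-ok fg gf = mk↔ₛ′
  (Refinement.map f (f-ok _)) (Refinement.map g (g-ok _))
  (λ y → value-injective (fg (value y)))
  (λ x → value-injective (gf (value x)))

module Recolouring {n c : ℕ} (block : Vec ℕ n) (a : Fin c) where
  open ≡-Reasoning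

  Saturated : Vec (Fin c) n → Fin n → Set
  Saturated col z = ∃[ x ] ∃[ y ]
    ( x < y × y < z
    × lookup block x ≡ lookup block z × lookup block y ≡ lookup block z
    × lookup col x ≡ a × lookup col y ≡ a )

  saturated? : ∀ col z → Dec (Saturated col z)
  saturated? col z = any? λ x → any? λ y →
    (x <? y) ×-dec (y <? z)
    ×-dec (lookup block x ℕ.≟ lookup block z) ×-dec (lookup block y ℕ.≟ lookup block z)
    ×-dec (lookup col x ≟ᶠ a) ×-dec (lookup col y ≟ᶠ a)

  saturated-later : ∀ col {k z} → k < z → lookup block k ≡ lookup block z →
    Saturated col k → Saturated col z
  saturated-later col k<z same (x , y , x<y , y<k , x∼k , y∼k , cx , cy) =
    x , y , x<y , <-trans y<k k<z , trans x∼k same , trans y∼k same , cx , cy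

  contains⇒saturated : ∀ col e → EqContains (block , col) a a e →
    ∃[ z ] (Saturated col z × lookup col z ≡ e)
  contains⇒saturated col e (x , y , z , x<y , y<z , x∼y , y∼z , cx , cy , cz) =
    z , (x , y , x<y , y<z , trans x∼y y∼z , y∼z , cx , cy) , cz

  saturated⇒contains : ∀ col e z → Saturated col z → lookup col z ≡ e →
    EqContains (block , col) a a e
  saturated⇒contains col e z (x , y , x<y , y<z , x∼z , y∼z , cx , cy) cz =
    x , y , z , x<y , y<z , trans x∼z (sym y∼z) , y∼z , cx , cy , cz

  recolourAt : (Fin c → Fin c) → Vec (Fin c) n → Fin n → Fin c
  recolourAt σ col z with saturated? col z
  ... | yes _ = σ (lookup col z)
  ... | no  _ = lookup col z

  recolour : (Fin c → Fin c) → Vec (Fin c) n → Vec (Fin c) n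
  recolour σ col = tabulate (recolourAt σ col)

  recolour-saturated : ∀ σ col z → Saturated col z →
    lookup (recolour σ col) z ≡ σ (lookup col z)
  recolour-saturated σ col z sat rewrite lookup∘tabulate (recolourAt σ col) z
    with saturated? col z
  ... | yes _    = refl
  ... | no unsat = contradiction sat unsat

  recolour-unsaturated : ∀ σ col z → ¬ Saturated col z →
    lookup (recolour σ col) z ≡ lookup col z
  recolour-unsaturated σ col z unsat rewrite lookup∘tabulate (recolourAt σ col) z
    with saturated? col z
  ... | yes sat = contradiction sat unsat
  ... | no _    = refl

  earlier-unsaturated : ∀ col {x y} → x < y → lookup block x ≡ lookup block y →
    ¬ Saturated col y → ¬ Saturated col x
  earlier-unsaturated col x<y x∼y unsat-y sat-x =
    unsat-y (saturated-later col x<y x∼y sat-x)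

  saturation-reflected : ∀ σ col z → Saturated (recolour σ col) z → Saturated col z
  saturation-reflected σ col z (x , y , x<y , y<z , x∼z , y∼z , cx , cy)
    with saturated? col y
  ... | yes sat-y  = saturated-later col y<z y∼z sat-y
  ... | no unsat-y = x , y , x<y , y<z , x∼z , y∼z
    , trans (sym (recolour-unsaturated σ col x unsat-x)) cx
    , trans (sym (recolour-unsaturated σ col y unsat-y)) cy
    where
    unsat-x : ¬ Saturated col x
    unsat-x = earlier-unsaturated col x<y (trans x∼z (sym y∼z)) unsat-y

  saturation-preserved : ∀ σ col z → Saturated col z → Saturated (recolour σ col) z
  saturation-preserved σ col z = preserved z (<-wellFounded z)
    where
    preserved : ∀ z → Acc _<_ z → Saturated col z → Saturated (recolour σ col) z
    preserved z (acc rec) (x , y , x<y , y<z , x∼z , y∼z , cx , cy)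
      with saturated? col y
    ... | yes sat-y  =
      saturated-later (recolour σ col) y<z y∼z (preserved y (rec y<z) sat-y)
    ... | no unsat-y = x , y , x<y , y<z , x∼z , y∼z
      , trans (recolour-unsaturated σ col x unsat-x) cx
      , trans (recolour-unsaturated σ col y unsat-y) cy
      where
      unsat-x : ¬ Saturated col x
      unsat-x = earlier-unsaturated col x<y (trans x∼z (sym y∼z)) unsat-y

  recolour-inverse : ∀ σ τ → (∀ x → τ (σ x) ≡ x) → ∀ col →
    recolour τ (recolour σ col) ≡ col
  recolour-inverse σ τ τσ col = Pointwise-≡⇒≡ (ext undone)
    where
    undone : ∀ z → lookup (recolour τ (recolour σ col)) z ≡ lookup col z
    undone z with saturated? col z
    ... | yes sat = begin
      lookup (recolour τ (recolour σ col)) z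
        ≡⟨ recolour-saturated τ (recolour σ col) z (saturation-preserved σ col z sat) ⟩
      τ (lookup (recolour σ col) z)
        ≡⟨ cong τ (recolour-saturated σ col z sat) ⟩
      τ (σ (lookup col z))
        ≡⟨ τσ (lookup col z) ⟩
      lookup col z ∎
    ... | no unsat = begin
      lookup (recolour τ (recolour σ col)) z
        ≡⟨ recolour-unsaturated τ (recolour σ col) z (unsat ∘ saturation-reflected σ col z) ⟩
      lookup (recolour σ col) z
        ≡⟨ recolour-unsaturated σ col z unsat ⟩
      lookup col z ∎

  recolour-reflects-containment : ∀ σ col {d e} → (∀ x → σ x ≡ e → x ≡ d) →
    EqContains (block , recolour σ col) a a e → EqContains (block , col) a a d
  recolour-reflects-containment σ col {d} {e} σ⁻¹e occurrence
    with contains⇒saturated (recolour σ col) e occurrence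
  ... | z , sat , cz = saturated⇒contains col d z sat-before (σ⁻¹e (lookup col z) σcz)
    where
    sat-before : Saturated col z
    sat-before = saturation-reflected σ col z sat
    σcz : σ (lookup col z) ≡ e
    σcz = trans (sym (recolour-saturated σ col z sat-before)) cz

recolourPart : ∀ {n c} → Fin c → (Fin c → Fin c) → RawColPart n c → RawColPart n c
recolourPart a σ (block , col) = block , Recolouring.recolour block a σ col

recolourPart-inverse : ∀ {n c} (a : Fin c) σ τ → (∀ x → τ (σ x) ≡ x) →
  (p : RawColPart n c) → recolourPart a τ (recolourPart a σ p) ≡ p
recolourPart-inverse a σ τ τσ (block , col) =
  cong (block ,_) (Recolouring.recolour-inverse block a σ τ τσ col)

recolourPart-avoids : ∀ {n c} (a : Fin c) σ {d e} → (∀ x → σ x ≡ e → x ≡ d) →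
  (p : RawColPart n c) → IsColPart p × ¬ EqContains p a a d →
  IsColPart (recolourPart a σ p) × ¬ EqContains (recolourPart a σ p) a a e
recolourPart-avoids a σ σ⁻¹e (block , col) (rgs , avoids) =
  rgs , avoids ∘ Recolouring.recolour-reflects-containment block a σ col σ⁻¹e

permute-last-colour : ∀ {n c} (π : Permutation c c) (a d : Fin c) →
  AvoidSet n c a a d ↔ AvoidSet n c a a (π ⟨$⟩ʳ d)
permute-last-colour π a d = refinement-↔
  (recolourPart a (π ⟨$⟩ʳ_)) (recolourPart a (π ⟨$⟩ˡ_))
  (recolourPart-avoids a (π ⟨$⟩ʳ_) π-injective)
  (recolourPart-avoids a (π ⟨$⟩ˡ_) π⁻¹-preimage)
  (recolourPart-inverse a (π ⟨$⟩ˡ_) (π ⟨$⟩ʳ_) (λ _ → inverseʳ π))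
  (recolourPart-inverse a (π ⟨$⟩ʳ_) (π ⟨$⟩ˡ_) (λ _ → inverseˡ π))
  where
  π-injective : ∀ x → π ⟨$⟩ʳ x ≡ π ⟨$⟩ʳ d → x ≡ d
  π-injective x eq = trans (sym (inverseˡ π)) (trans (cong (π ⟨$⟩ˡ_) eq) (inverseˡ π))
  π⁻¹-preimage : ∀ x → π ⟨$⟩ˡ x ≡ d → x ≡ π ⟨$⟩ʳ d
  π⁻¹-preimage x eq = trans (sym (inverseʳ π)) (cong (π ⟨$⟩ʳ_) eq)

-- Theorem: |Π_n^eq ≀ C_c(1^a1^a1^a)| = |Π_n^eq ≀ C_c(1^a1^a1^b)|, via the
-- transposition (a b), which sends the last colour a to b.
mainTheorem18 : (c n : ℕ) → 2 ≤ c → 1 ≤ n → (a b : Fin c) → a ≢ b →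
    AvoidSet n c a a a ↔ AvoidSet n c a a b
mainTheorem18 c n _ _ a b _ =
  subst (λ e → AvoidSet n c a a a ↔ AvoidSet n c a a e)
    (transpose-sends a b) (permute-last-colour (transpose a b) a a)
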